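{- Let $\lambda,\mu,\pi$ be partitions with $|\lambda|=|\mu|+|\pi|$, let $\iota=|\lambda|+\lambda_1$, and let $\tilde\lambda=(3\iota-|\lambda|,\lambda_1,\lambda_2,\dots)$, $\tilde\mu=(3\iota-|\mu|,\mu_1,\mu_2,\dots)$, $\tilde\pi=(3\iota-|\pi|,\pi_1,\pi_2,\dots)$, so that $|\tilde\lambda|=|\tilde\mu|=|\tilde\pi|=3\iota$. Then $t^{\tilde\lambda}_{\tilde\mu,\tilde\pi}>0$.
   Context: For a partition $\alpha$, $\alpha^T$ is the vector of its column lengths (transpose partition). For finite $P\subseteq\mathbb{N}^3$ the marginals are $(x_P,y_P,z_P)$ with $x_P(i)$ the number of points of $P$ with $x$-coordinate $i$, etc. For partitions $\lambda,\mu,\pi$ of equal size, $t^\lambda_{\mu,\pi}$ is the number of finite $P\subseteq\mathbb{N}^3$ with marginals $(\lambda^T,\mu^T,\pi^T)$. -}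

module Defs where

open import Data.Nat using (ℕ; zero; suc; _+_; _*_; _∸_; _<_; _<?_; _≥_)
open import Data.Nat.Properties using (_≟_)
open import Data.List using (List; []; _∷_; length; filter)
open import Data.Nat.ListAction using (sum)
open import Data.List.Relation.Unary.All using (All)
open import Data.List.Relation.Unary.Unique.Propositional using (Unique)
open import Data.List.Relation.Unary.Sorted.TotalOrder using (Sorted)
open import Data.Product using (_×_; _,_; proj₁; proj₂; ∃)
open import Relation.Binary.PropositionalEquality using (_≡_)
import Data.Nat.Properties as ℕₚ
import Relation.Binary.Construct.Flip.EqAndOrd as Flip

IsPartition : List ℕ → Set
IsPartition α = Sorted (Flip.totalOrder ℕₚ.≤-totalOrder) α × All (0 <_) α

size : List ℕ → ℕ
size = sum

firstPart : List ℕ → ℕ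
firstPart []      = 0
firstPart (a ∷ _) = a

-- transpose partition as a function of the (0-based) column index:
-- α^T(j) = #{ i : α_i > j }, which is 0 for j ≥ α₁.
transpose : List ℕ → ℕ → ℕ
transpose α j = length (filter (j <?_) α)

Point : Set
Point = ℕ × ℕ × ℕ

xc yc zc : Point → ℕ
xc (a , _ , _) = a
yc (_ , b , _) = b
zc (_ , _ , c) = c

xMarg yMarg zMarg : List Point → ℕ → ℕ
xMarg P i = length (filter (λ p → xc p ≟ i) P)
yMarg P i = length (filter (λ p → yc p ≟ i) P)
zMarg P i = length (filter (λ p → zc p ≟ i) P)

HasMarginals : List Point → List ℕ → List ℕ → List ℕ → Set
HasMarginals P l m p =
  (∀ i → xMarg P i ≡ transpose l i) ×
  (∀ i → yMarg P i ≡ transpose m i) ×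
  (∀ i → zMarg P i ≡ transpose p i)

-- t^λ_{μ,π} > 0 : there is at least one finite P ⊆ ℕ³ with marginals (λ^T, μ^T, π^T)
tPositive : List ℕ → List ℕ → List ℕ → Set
tPositive l m p = ∃ λ (P : List Point) → Unique P × HasMarginals P l m p

iota : List ℕ → ℕ
iota l = size l + firstPart l

tilde : ℕ → List ℕ → List ℕ
tilde ι α = (3 * ι ∸ size α) ∷ α

module Submission where

-- A point set P ⊆ ℕ³ has x-marginal α^T exactly when the multiset of its
-- x-coordinates is the multiset `cells α` of column indices of the boxes of
-- the diagram of α (column j occurs α^T(j) times).  So it suffices to build
-- a duplicate-free point list whose three coordinate lists are permutations
-- of `cells` of the three padded partitions.
--
-- Write a = |μ|, b = |π|, n = a + b = |λ|.  For any padding K the point set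
--   Bλ = { (cλ, t, t)      : t < n }          (cλ running through cells λ)
--   Bμ = { (t, cμ, n + t)  : t < a }
--   Bπ = { (a + t, n + t, cπ) : t < b }
--   BK = { (n + t, n + b + t, n + a + t) : t < K }
-- has coordinate multisets cells (n + K ∷ λ), cells (n + b + K ∷ μ) and
-- cells (n + a + K ∷ π): each coordinate consists of one copy of the cells
-- of a partition plus intervals tiling [0, first part).  The points are
-- distinct because inside each block one coordinate runs through an
-- interval, and the blocks are separated by coordinate bounds.  Choosing
-- K = n + 3λ₁ makes the first parts equal 3ι − |λ|, 3ι − |μ|, 3ι − |π|.

open import Defs
open import Data.Nat using (ℕ; zero; suc; _+_; _*_; _∸_; _<_; _≤_; _<?_)
open import Data.Nat.Properties
  using (_≟_; m+n∸m≡n; m≤m+n; +-monoʳ-<; <⇒≢; ≤⇒≯; ≤-trans; suc-injective)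
open import Data.Nat.Tactic.RingSolver using (solve-∀)
open import Data.List using (List; []; _∷_; _++_; length; filter; map; zip; upTo; applyUpTo; concatMap)
open import Data.List.Properties
  using (length-++; filter-++; filter-accept; filter-reject; filter-≐; map-++; ++-assoc; length-applyUpTo; length-upTo; map-upTo)
open import Data.List.Relation.Unary.All as All using (All)
import Data.List.Relation.Unary.All.Properties as All
open import Data.List.Relation.Unary.Unique.Propositional using (Unique)
import Data.List.Relation.Unary.Unique.Propositional.Properties as Unique
open import Data.List.Relation.Binary.Permutation.Propositional using (_↭_; module PermutationReasoning)
open import Data.List.Relation.Binary.Permutation.Propositional.Properties
  using (↭-length; filter-↭; ++-comm; ++⁺ˡ)
open import Data.Product using (_×_; _,_)
open import Function using (_∘_)
open import Relation.Nullary using (¬_; yes; no; does)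
open import Data.Bool using (true; false)
open import Relation.Binary.PropositionalEquality

occurrences : ℕ → List ℕ → ℕ
occurrences i xs = length (filter (_≟ i) xs)

occurrences-++ : ∀ i xs ys → occurrences i (xs ++ ys) ≡ occurrences i xs + occurrences i ys
occurrences-++ i xs ys = trans (cong length (filter-++ (_≟ i) xs ys)) (length-++ (filter (_≟ i) xs))

occurrences-↭ : ∀ i {xs ys} → xs ↭ ys → occurrences i xs ≡ occurrences i ys
occurrences-↭ i σ = ↭-length (filter-↭ (_≟ i) σ)

occurrences-map : ∀ {A : Set} (f : A → ℕ) i (P : List A) →
  length (filter (λ q → f q ≟ i) P) ≡ occurrences i (map f P)
occurrences-map f i [] = refl
occurrences-map f i (q ∷ P) with f q ≟ i
... | yes fq≡i = begin
  length (filter (λ q → f q ≟ i) (q ∷ P)) ≡⟨ cong length (filter-accept (λ q → f q ≟ i) fq≡i) ⟩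
  suc (length (filter (λ q → f q ≟ i) P)) ≡⟨ cong suc (occurrences-map f i P) ⟩
  suc (occurrences i (map f P))           ≡⟨ cong length (filter-accept (_≟ i) fq≡i) ⟨
  occurrences i (map f (q ∷ P))           ∎
  where open ≡-Reasoning
... | no  fq≢i = begin
  length (filter (λ q → f q ≟ i) (q ∷ P)) ≡⟨ cong length (filter-reject (λ q → f q ≟ i) fq≢i) ⟩
  length (filter (λ q → f q ≟ i) P)       ≡⟨ occurrences-map f i P ⟩
  occurrences i (map f P)                 ≡⟨ cong length (filter-reject (_≟ i) fq≢i) ⟨
  occurrences i (map f (q ∷ P))           ∎
  where open ≡-Reasoning

occurrences-zero-map-suc : ∀ xs → occurrences 0 (map suc xs) ≡ 0
occurrences-zero-map-suc []       = refl
occurrences-zero-map-suc (_ ∷ xs) = occurrences-zero-map-suc xs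

occurrences-suc-map-suc : ∀ j xs → occurrences (suc j) (map suc xs) ≡ occurrences j xs
occurrences-suc-map-suc j xs = begin
  occurrences (suc j) (map suc xs)         ≡⟨ occurrences-map suc (suc j) xs ⟨
  length (filter (λ x → suc x ≟ suc j) xs) ≡⟨ cong length (filter-≐ _ (_≟ j) (suc-injective , cong suc) xs) ⟩
  occurrences j xs                         ∎
  where open ≡-Reasoning

transpose-row-suc : ∀ r j → transpose (suc r ∷ []) (suc j) ≡ transpose (r ∷ []) j
transpose-row-suc r j with does (j <? r)
... | true  = refl
... | false = refl

occurrences-upTo : ∀ r j → occurrences j (upTo r) ≡ transpose (r ∷ []) j
occurrences-upTo zero    j       = refl
occurrences-upTo (suc r) zero    =
  cong suc (trans (cong (occurrences 0) (sym (map-upTo suc r)))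
                  (occurrences-zero-map-suc (upTo r)))
occurrences-upTo (suc r) (suc j) = begin
  occurrences (suc j) (applyUpTo suc r)  ≡⟨ cong (occurrences (suc j)) (map-upTo suc r) ⟨
  occurrences (suc j) (map suc (upTo r)) ≡⟨ occurrences-suc-map-suc j (upTo r) ⟩
  occurrences j (upTo r)                 ≡⟨ occurrences-upTo r j ⟩
  transpose (r ∷ []) j                   ≡⟨ transpose-row-suc r j ⟨
  transpose (suc r ∷ []) (suc j)         ∎
  where open ≡-Reasoning

-- The multiset of column indices of the boxes of the diagram of α:
-- column j occurs α^T(j) times, and there are |α| entries in total.
cells : List ℕ → List ℕ
cells = concatMap upTo

length-cells : ∀ α → length (cells α) ≡ size α
length-cells []      = refl
length-cells (r ∷ α) =
  trans (length-++ (upTo r)) (cong₂ _+_ (length-upTo r) (length-cells α))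

transpose-∷ : ∀ r α j → transpose (r ∷ α) j ≡ transpose (r ∷ []) j + transpose α j
transpose-∷ r α j =
  trans (cong length (filter-++ (j <?_) (r ∷ []) α)) (length-++ (filter (j <?_) (r ∷ [])))

occurrences-cells : ∀ α j → occurrences j (cells α) ≡ transpose α j
occurrences-cells []      j = refl
occurrences-cells (r ∷ α) j = begin
  occurrences j (upTo r ++ cells α)                 ≡⟨ occurrences-++ j (upTo r) (cells α) ⟩
  occurrences j (upTo r) + occurrences j (cells α)  ≡⟨ cong₂ _+_ (occurrences-upTo r j) (occurrences-cells α j) ⟩
  transpose (r ∷ []) j + transpose α j              ≡⟨ transpose-∷ r α j ⟨
  transpose (r ∷ α) j                               ∎
  where open ≡-Reasoning

marginals-from-coordinates : ∀ {P} l m p →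
  map xc P ↭ cells l → map yc P ↭ cells m → map zc P ↭ cells p → HasMarginals P l m p
marginals-from-coordinates {P} l m p σx σy σz =
  marginal xc l σx , marginal yc m σy , marginal zc p σz
  where
  marginal : ∀ (f : Point → ℕ) α → map f P ↭ cells α →
             ∀ i → length (filter (λ q → f q ≟ i) P) ≡ transpose α i
  marginal f α σ i =
    trans (occurrences-map f i P) (trans (occurrences-↭ i σ) (occurrences-cells α i))

range : ℕ → ℕ → List ℕ
range a n = applyUpTo (a +_) n

length-range : ∀ a n → length (range a n) ≡ n
length-range a n = length-applyUpTo (a +_) n

range-unique : ∀ a n → Unique (range a n)
range-unique a n = Unique.applyUpTo⁺₁ (a +_) n (λ i<j _ → <⇒≢ (+-monoʳ-< a i<j))

range-lower : ∀ a n → All (a ≤_) (range a n)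
range-lower a n = All.applyUpTo⁺₁ (a +_) n (λ {i} _ → m≤m+n a i)

range-upper : ∀ a n → All (_< a + n) (range a n)
range-upper a n = All.applyUpTo⁺₁ (a +_) n (+-monoʳ-< a)

applyUpTo-++ : ∀ {A : Set} (f : ℕ → A) n k →
  applyUpTo f (n + k) ≡ applyUpTo f n ++ applyUpTo (f ∘ (n +_)) k
applyUpTo-++ f zero    k = refl
applyUpTo-++ f (suc n) k = cong (f 0 ∷_) (applyUpTo-++ (f ∘ suc) n k)

upTo-split : ∀ x y z → upTo ((x + y) + z) ≡ upTo x ++ range x y ++ range (x + y) z
upTo-split x y z = begin
  upTo ((x + y) + z)                          ≡⟨ applyUpTo-++ (λ i → i) (x + y) z ⟩
  upTo (x + y) ++ range (x + y) z             ≡⟨ cong (_++ range (x + y) z) (applyUpTo-++ (λ i → i) x y) ⟩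
  (upTo x ++ range x y) ++ range (x + y) z    ≡⟨ ++-assoc (upTo x) (range x y) (range (x + y) z) ⟩
  upTo x ++ range x y ++ range (x + y) z      ∎
  where open ≡-Reasoning

block : List ℕ → List ℕ → List ℕ → List Point
block xs ys zs = zip xs (zip ys zs)

record Coordinates (B : List Point) (xs ys zs : List ℕ) : Set where
  field
    x-coords : map xc B ≡ xs
    y-coords : map yc B ≡ ys
    z-coords : map zc B ≡ zs
open Coordinates

block-coordinates : ∀ {k} xs ys zs → length xs ≡ k → length ys ≡ k → length zs ≡ k →
  Coordinates (block xs ys zs) xs ys zs
block-coordinates [] [] [] _ _ _ = record { x-coords = refl ; y-coords = refl ; z-coords = refl }
block-coordinates (x ∷ xs) (y ∷ ys) (z ∷ zs) refl ey ez =
  record { x-coords = cong (x ∷_) (x-coords rest)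
         ; y-coords = cong (y ∷_) (y-coords rest)
         ; z-coords = cong (z ∷_) (z-coords rest) }
  where rest = block-coordinates xs ys zs refl (suc-injective ey) (suc-injective ez)
block-coordinates []      (_ ∷ _) _       refl () _
block-coordinates []      []      (_ ∷ _) refl _  ()
block-coordinates (_ ∷ _) []      _       refl () _
block-coordinates (_ ∷ _) (_ ∷ _) []      refl _  ()

coordinate-unique : ∀ (f : Point → ℕ) {P xs} → map f P ≡ xs → Unique xs → Unique P
coordinate-unique f e u = Unique.map⁻ (subst Unique (sym e) u)

coordinate-All : ∀ (f : Point → ℕ) {A : ℕ → Set} {P xs} → map f P ≡ xs → All A xs → All (A ∘ f) P
coordinate-All f e a = All.map⁻ (subst (All _) (sym e) a)

separated-++ : ∀ {Q : Point → Set} {P R} → Unique P → Unique R →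
  All Q P → All (λ q → ¬ Q q) R → Unique (P ++ R)
separated-++ uP uR qP ¬qR = Unique.++⁺ uP uR (λ (i , j) → All.lookup ¬qR j (All.lookup qP i))

move-to-end : ∀ (xs c ys : List ℕ) → xs ++ c ++ ys ↭ (xs ++ ys) ++ c
move-to-end xs c ys = begin
  xs ++ c ++ ys    ↭⟨ ++⁺ˡ xs (++-comm c ys) ⟩
  xs ++ ys ++ c    ≡⟨ ++-assoc xs ys c ⟨
  (xs ++ ys) ++ c  ∎
  where open PermutationReasoning

-- No ordering or positivity of the parts is needed.
module PaddedConstruction (l m p : List ℕ) (K : ℕ) (hl : size l ≡ size m + size p) where
  a b n : ℕ
  a = size m
  b = size p
  n = a + b

  Bλ Bμ Bπ BK witness : List Point
  Bλ = block (cells l) (upTo n) (upTo n)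
  Bμ = block (upTo a) (cells m) (range n a)
  Bπ = block (range a b) (range n b) (cells p)
  BK = block (range n K) (range (n + b) K) (range (n + a) K)
  witness = Bλ ++ Bμ ++ Bπ ++ BK

  coordsλ : Coordinates Bλ (cells l) (upTo n) (upTo n)
  coordsλ = block-coordinates (cells l) (upTo n) (upTo n)
    (trans (length-cells l) hl) (length-upTo n) (length-upTo n)

  coordsμ : Coordinates Bμ (upTo a) (cells m) (range n a)
  coordsμ = block-coordinates (upTo a) (cells m) (range n a)
    (length-upTo a) (length-cells m) (length-range n a)

  coordsπ : Coordinates Bπ (range a b) (range n b) (cells p)
  coordsπ = block-coordinates (range a b) (range n b) (cells p)
    (length-range a b) (length-range n b) (length-cells p)

  coordsK : Coordinates BK (range n K) (range (n + b) K) (range (n + a) K)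
  coordsK = block-coordinates (range n K) (range (n + b) K) (range (n + a) K)
    (length-range n K) (length-range (n + b) K) (length-range (n + a) K)

  -- Separation of the blocks: Bλ has its y- and z-coordinates below n,
  -- while Bμ has z ≥ n and Bπ, BK have y ≥ n; then Bμ has x < a while
  -- Bπ, BK have x ≥ a; finally Bπ has x < n while BK has x ≥ n.
  inside-λ : All (λ q → yc q < n × zc q < n) Bλ
  inside-λ = All.zip ( coordinate-All yc (y-coords coordsλ) (range-upper 0 n)
                     , coordinate-All zc (z-coords coordsλ) (range-upper 0 n))

  outside-λ : All (λ q → ¬ (yc q < n × zc q < n)) (Bμ ++ Bπ ++ BK)
  outside-λ = All.++⁺
    (All.map (λ n≤z (_ , z<n) → ≤⇒≯ n≤z z<n) (coordinate-All zc (z-coords coordsμ) (range-lower n a)))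
    (All.++⁺
      (All.map (λ n≤y (y<n , _) → ≤⇒≯ n≤y y<n) (coordinate-All yc (y-coords coordsπ) (range-lower n b)))
      (All.map (λ n+b≤y (y<n , _) → ≤⇒≯ (≤-trans (m≤m+n n b) n+b≤y) y<n)
               (coordinate-All yc (y-coords coordsK) (range-lower (n + b) K))))

  inside-μ : All (λ q → xc q < a) Bμ
  inside-μ = coordinate-All xc (x-coords coordsμ) (range-upper 0 a)

  outside-μ : All (λ q → ¬ xc q < a) (Bπ ++ BK)
  outside-μ = All.++⁺
    (coordinate-All xc (x-coords coordsπ) (All.map ≤⇒≯ (range-lower a b)))
    (coordinate-All xc (x-coords coordsK) (All.map (≤⇒≯ ∘ ≤-trans (m≤m+n a b)) (range-lower n K)))

  inside-π : All (λ q → xc q < n) Bπ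
  inside-π = coordinate-All xc (x-coords coordsπ) (range-upper a b)

  outside-π : All (λ q → ¬ xc q < n) BK
  outside-π = coordinate-All xc (x-coords coordsK) (All.map ≤⇒≯ (range-lower n K))

  -- Within each block one coordinate runs through an interval.
  witness-unique : Unique witness
  witness-unique =
    separated-++ (coordinate-unique yc (y-coords coordsλ) (range-unique 0 n))
      (separated-++ (coordinate-unique zc (z-coords coordsμ) (range-unique n a))
        (separated-++ (coordinate-unique yc (y-coords coordsπ) (range-unique n b))
                      (coordinate-unique xc (x-coords coordsK) (range-unique n K))
                      inside-π outside-π)
        inside-μ outside-μ)
      inside-λ outside-λ

  witness-coordinates : ∀ (f : Point → ℕ) {cλ cμ cπ cK} →
    map f Bλ ≡ cλ → map f Bμ ≡ cμ → map f Bπ ≡ cπ → map f BK ≡ cK →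
    map f witness ≡ cλ ++ cμ ++ cπ ++ cK
  witness-coordinates f refl refl refl refl =
    trans (map-++ f Bλ _) (cong (map f Bλ ++_)
      (trans (map-++ f Bμ _) (cong (map f Bμ ++_) (map-++ f Bπ BK))))

  -- In each direction the intervals tile [0, first part) and the cells of
  -- one partition are added once.
  x-multiset : map xc witness ↭ cells (n + K ∷ l)
  x-multiset = begin
    map xc witness
      ≡⟨ witness-coordinates xc (x-coords coordsλ) (x-coords coordsμ) (x-coords coordsπ) (x-coords coordsK) ⟩
    cells l ++ upTo a ++ range a b ++ range n K
      ↭⟨ move-to-end [] (cells l) (upTo a ++ range a b ++ range n K) ⟩
    (upTo a ++ range a b ++ range n K) ++ cells l
      ≡⟨ cong (_++ cells l) (upTo-split a b K) ⟨
    cells (n + K ∷ l) ∎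
    where open PermutationReasoning

  y-multiset : map yc witness ↭ cells ((n + b) + K ∷ m)
  y-multiset = begin
    map yc witness
      ≡⟨ witness-coordinates yc (y-coords coordsλ) (y-coords coordsμ) (y-coords coordsπ) (y-coords coordsK) ⟩
    upTo n ++ cells m ++ range n b ++ range (n + b) K
      ↭⟨ move-to-end (upTo n) (cells m) (range n b ++ range (n + b) K) ⟩
    (upTo n ++ range n b ++ range (n + b) K) ++ cells m
      ≡⟨ cong (_++ cells m) (upTo-split n b K) ⟨
    cells ((n + b) + K ∷ m) ∎
    where open PermutationReasoning

  z-multiset : map zc witness ↭ cells ((n + a) + K ∷ p)
  z-multiset = begin
    map zc witness
      ≡⟨ witness-coordinates zc (z-coords coordsλ) (z-coords coordsμ) (z-coords coordsπ) (z-coords coordsK) ⟩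
    upTo n ++ range n a ++ cells p ++ range (n + a) K
      ↭⟨ ++⁺ˡ (upTo n) (move-to-end (range n a) (cells p) (range (n + a) K)) ⟩
    upTo n ++ (range n a ++ range (n + a) K) ++ cells p
      ≡⟨ ++-assoc (upTo n) (range n a ++ range (n + a) K) (cells p) ⟨
    (upTo n ++ range n a ++ range (n + a) K) ++ cells p
      ≡⟨ cong (_++ cells p) (upTo-split n a K) ⟨
    cells ((n + a) + K ∷ p) ∎
    where open PermutationReasoning

  padded-realizable : tPositive (n + K ∷ l) ((n + b) + K ∷ m) ((n + a) + K ∷ p)
  padded-realizable =
    witness , witness-unique ,
    marginals-from-coordinates (n + K ∷ l) ((n + b) + K ∷ m) ((n + a) + K ∷ p)
                               x-multiset y-multiset z-multiset

open PaddedConstruction using (padded-realizable)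

tilde-head : ∀ ι {x} α → size α + x ≡ 3 * ι → tilde ι α ≡ x ∷ α
tilde-head ι {x} α e = cong (_∷ α) (trans (cong (_∸ size α) (sym e)) (m+n∸m≡n (size α) x))

tPositive-tilde : ∀ ι {x y z} l m p →
  size l + x ≡ 3 * ι → size m + y ≡ 3 * ι → size p + z ≡ 3 * ι →
  tPositive (x ∷ l) (y ∷ m) (z ∷ p) → tPositive (tilde ι l) (tilde ι m) (tilde ι p)
tPositive-tilde ι {x} {y} l m p el em ep t =
  subst (λ α → tPositive α (tilde ι m) (tilde ι p)) (sym (tilde-head ι l el))
    (subst (λ β → tPositive (x ∷ l) β (tilde ι p)) (sym (tilde-head ι m em))
      (subst (tPositive (x ∷ l) (y ∷ m)) (sym (tilde-head ι p ep)) t))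

padding-λ : ∀ a b f → (a + b) + ((a + b) + ((a + b) + 3 * f)) ≡ 3 * ((a + b) + f)
padding-λ = solve-∀

padding-μ : ∀ a b f → a + (((a + b) + b) + ((a + b) + 3 * f)) ≡ 3 * ((a + b) + f)
padding-μ = solve-∀

padding-π : ∀ a b f → b + (((a + b) + a) + ((a + b) + 3 * f)) ≡ 3 * ((a + b) + f)
padding-π = solve-∀

-- Theorem 6.3: the padded construction with K = |λ| + 3λ₁ realises the tilde
-- triple.
theorem6p3 : (l m p : List ℕ) → IsPartition l → IsPartition m → IsPartition p →
    size l ≡ size m + size p →
    tPositive (tilde (iota l) l) (tilde (iota l) m) (tilde (iota l) p)
theorem6p3 l m p _ _ _ hl =
  tPositive-tilde (iota l) l m p
    (trans (cong (_+ (n + K)) hl) (trans (padding-λ a b f) (sym three-ι)))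
    (trans (padding-μ a b f) (sym three-ι))
    (trans (padding-π a b f) (sym three-ι))
    (padded-realizable l m p K hl)
  where
  a b n f K : ℕ
  a = size m
  b = size p
  n = a + b
  f = firstPart l
  K = n + 3 * f
  three-ι : 3 * iota l ≡ 3 * (n + f)
  three-ι = cong (λ s → 3 * (s + f)) hl
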